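{- Consider two sorted (non-increasing) bid vectors $\mathbf b=[b_1,\dots,b_k]$ and $\mathbf b'=[b_1',\dots,b_k']$ with $b_j\ge b_j'$ for all $j\in[k]$. If $\mathbf b$ is RoI feasible for some competing bids $\boldsymbol\beta_-$, then $\mathbf b'$ is also RoI feasible for $\boldsymbol\beta_-$ and $V(\mathbf b;\boldsymbol\beta_-)\ge V(\mathbf b';\boldsymbol\beta_-)$.
   Context: A uniform price auction sells $K$ identical units. The bidder has valuation $v_1\ge\dots\ge v_M>0$ and $w_j=\frac1j\sum_{\ell\le j}v_\ell$. The bidder submits a bid vector (one bid per unit, possibly repeated values). Given competing bids $\boldsymbol\beta_-$, the $K$ highest of all bids win one unit each (ties in favor of the bidder); $x$ is the bidder's number of winning bids, the per-unit price $p$ is the $K$-th highest bid, $V(\mathbf b;\boldsymbol\beta_-)=\sum_{j\le x}v_j$, $P(\mathbf b;\boldsymbol\beta_-)=px$ (both $0$ if $x=0$). $\mathbf b$ is RoI feasible for $\boldsymbol\beta_-$ if $V\ge P$, i.e., $p\le w_x$ whenever $x\ge1$.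
   Formalization: The bids in both vectors, the competing bids and the valuations are all rational numbers. -}

module Defs where

open import Data.Nat as ℕ using (ℕ; zero; suc; _∸_; _≤ᵇ_)
open import Data.Fin as Fin using (Fin; toℕ)
open import Data.Integer using (+_)
open import Data.Rational using (ℚ; 0ℚ; _+_; _*_; _/_; _≤_; _<_)
open import Data.Rational.Properties using (≤-decTotalOrder; _<?_)
open import Data.List as List using (List; []; _∷_; filter; length; reverse; drop; _++_)
open import Data.Vec as Vec using (Vec; []; _∷_; lookup; toList)
open import Data.Maybe using (fromMaybe)
open import Data.Bool using (if_then_else_)
open import Data.List.Sort ≤-decTotalOrder using (sort)

ℕtoℚ : ℕ → ℚ
ℕtoℚ n = (+ n) / 1

NonIncreasing : ∀ {n} → Vec ℚ n → Set
NonIncreasing {n} u = ∀ (i j : Fin n) → i Fin.≤ j → lookup u j ≤ lookup u i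

countAbove : ℚ → List ℚ → ℕ
countAbove t β = length (filter (t <?_) β)

-- With ties broken in favour of the bidder, the bidder's j-th bid (1-based)
-- has overall rank  j + #{competing bids > b_j}, and wins iff this rank ≤ K.
winsFrom : ℕ → ℕ → ∀ {n} → Vec ℚ n → List ℚ → ℕ
winsFrom K j [] β = 0
winsFrom K j (b ∷ bs) β =
  (if (suc j ℕ.+ countAbove b β) ≤ᵇ K then 1 else 0) ℕ.+ winsFrom K (suc j) bs β

alloc : (K : ℕ) → ∀ {k} → Vec ℚ k → List ℚ → ℕ
alloc K b β = winsFrom K 0 b β

sortDesc : List ℚ → List ℚ
sortDesc xs = reverse (sort xs)

-- K-th highest of all bids (0 if there are fewer than K bids in total)
price : (K : ℕ) → ∀ {k} → Vec ℚ k → List ℚ → ℚ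
price K b β = fromMaybe 0ℚ (List.head (drop (K ∸ 1) (sortDesc (toList b ++ β))))

sumFirst : ℕ → ∀ {M} → Vec ℚ M → ℚ
sumFirst zero v = 0ℚ
sumFirst (suc x) [] = 0ℚ
sumFirst (suc x) (a ∷ v) = a + sumFirst x v

value : (K : ℕ) → ∀ {M} → Vec ℚ M → ∀ {k} → Vec ℚ k → List ℚ → ℚ
value K v b β = sumFirst (alloc K b β) v

payment : (K : ℕ) → ∀ {k} → Vec ℚ k → List ℚ → ℚ
payment K b β = price K b β * ℕtoℚ (alloc K b β)

RoIFeasible : (K : ℕ) → ∀ {M} → Vec ℚ M → ∀ {k} → Vec ℚ k → List ℚ → Set
RoIFeasible K v b β = payment K b β ≤ value K v b β

-- Lowering every bid can only lower the number x of units won, since each bid then faces at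
-- least as many higher competing bids, and the clearing price p, since by counting bids the
-- K-th highest entry of a pointwise smaller list is smaller. RoI feasibility says p ≤ wₓ; as
-- v is non-increasing so is the running average w, hence p′ ≤ p ≤ wₓ ≤ wₓ′ for the new
-- price p′ and quantity x′ ≤ x. The value is monotone in x because valuations are positive.

module Submission where

open import Defs
open import Data.Nat using (ℕ; _≤_)
open import Data.Fin using (Fin)
open import Data.Rational using (ℚ; 0ℚ; _<_) renaming (_≤_ to _≤ℚ_)
open import Data.List using (List)
open import Data.Vec using (Vec; lookup)
open import Data.Product using (_×_)

open import Algebra.Bundles using (CommutativeMonoid)
import Algebra.Properties.CommutativeSemigroup as CommutativeSemigroupProperties
open import Data.Bool using (true; false; if_then_else_)
open import Data.Fin using (zero; suc)
import Data.Integer as ℤ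
import Data.Integer.Properties as ℤ
open import Data.List using ([]; _∷_; length; filter; drop; reverse; head)
open import Data.List.Properties
  using (length-drop; filter-none; filter-accept; filter-reject; unfold-reverse)
open import Data.List.Relation.Binary.Permutation.Propositional using (_↭_; ↭-trans; ↭-sym)
open import Data.List.Relation.Binary.Permutation.Propositional.Properties
  using (↭-length; filter-↭; ↭-reverse; All-resp-↭)
open import Data.List.Relation.Binary.Pointwise as Pointwise using (Pointwise; []; _∷_; Pointwise-length)
open import Data.List.Relation.Unary.All as All using (All; []; _∷_)
open import Data.List.Relation.Unary.All.Properties as All using (drop⁺)
open import Data.List.Relation.Unary.AllPairs as AllPairs using (AllPairs; []; _∷_)
import Data.List.Relation.Unary.AllPairs.Properties as AllPairs
open import Data.List.Relation.Unary.Linked.Properties using (Linked⇒AllPairs)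
open import Data.Maybe using (fromMaybe)
open import Data.Nat using (zero; suc; z≤n; s≤s; _∸_; _≤ᵇ_; _≤′_; ≤′-refl; ≤′-step)
import Data.Nat.Properties as ℕ
open import Data.Rational using (1ℚ; _+_; _*_; _≥_; NonNegative; toℚᵘ)
import Data.Rational.Properties as ℚ
open import Data.List.Sort ℚ.≤-decTotalOrder using (sort; sort-↭; sort-↗)
open import Data.Rational.Unnormalised as ℚᵘ using (mkℚᵘ; *≡*; 1ℚᵘ)
import Data.Rational.Unnormalised.Properties as ℚᵘ
open import Data.Vec using ([]; _∷_; toList)
open import Data.Product using (_,_)
open import Function using (_∘_; flip)
open import Level using (Level)
open import Relation.Binary.Core using (REL)
open import Relation.Binary.PropositionalEquality
open import Relation.Nullary using (¬_; yes; no; contradiction)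
open import Relation.Nullary.Reflects using (ofʸ; ofⁿ)
open import Relation.Unary using (Pred; Decidable)

private
  variable
    a b p q r : Level
    A : Set a
    B : Set b
    M n : ℕ

ℕtoℚ-suc : ∀ n → ℕtoℚ (suc n) ≡ 1ℚ + ℕtoℚ n
ℕtoℚ-suc n = ℚ.toℚᵘ-injective (begin
  toℚᵘ (ℕtoℚ (suc n))        ≈⟨ ℚ.toℚᵘ-fromℚᵘ (mkℚᵘ (ℤ.+ suc n) 0) ⟩
  mkℚᵘ (ℤ.+ suc n) 0          ≈⟨ *≡* (cong (λ z → (ℤ.+ 1 ℤ.+ z) ℤ.* ℤ.+ 1)
                                          (sym (ℤ.*-identityʳ (ℤ.+ n)))) ⟩
  1ℚᵘ ℚᵘ.+ mkℚᵘ (ℤ.+ n) 0     ≈⟨ ℚᵘ.+-congʳ 1ℚᵘ (ℚ.toℚᵘ-fromℚᵘ (mkℚᵘ (ℤ.+ n) 0)) ⟨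
  toℚᵘ 1ℚ ℚᵘ.+ toℚᵘ (ℕtoℚ n)  ≈⟨ ℚ.toℚᵘ-homo-+ 1ℚ (ℕtoℚ n) ⟨
  toℚᵘ (1ℚ + ℕtoℚ n)          ∎)
  where open ℚᵘ.≃-Reasoning

*-ℕtoℚ-suc : ∀ p n → p * ℕtoℚ (suc n) ≡ p + p * ℕtoℚ n
*-ℕtoℚ-suc p n = begin
  p * ℕtoℚ (suc n)       ≡⟨ cong (p *_) (ℕtoℚ-suc n) ⟩
  p * (1ℚ + ℕtoℚ n)      ≡⟨ ℚ.*-distribˡ-+ p 1ℚ (ℕtoℚ n) ⟩
  p * 1ℚ + p * ℕtoℚ n    ≡⟨ cong (_+ p * ℕtoℚ n) (ℚ.*-identityʳ p) ⟩
  p + p * ℕtoℚ n         ∎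
  where open ≡-Reasoning

ℕtoℚ-nonNeg : ∀ n → NonNegative (ℕtoℚ n)
ℕtoℚ-nonNeg n = ℚ.normalize-nonNeg n 1

*-monoʳ-≤-ℕtoℚ : ∀ n {p q} → p ≤ℚ q → p * ℕtoℚ n ≤ℚ q * ℕtoℚ n
*-monoʳ-≤-ℕtoℚ n = ℚ.*-monoʳ-≤-nonNeg (ℕtoℚ n) {{ℕtoℚ-nonNeg n}}

-- 0 past the end of the vector, consistently with sumFirst.
entry : Vec ℚ M → ℕ → ℚ
entry []      _       = 0ℚ
entry (x ∷ v) zero    = x
entry (x ∷ v) (suc y) = entry v y

NonNegativeEntries : Vec ℚ M → Set
NonNegativeEntries v = ∀ i → 0ℚ ≤ℚ lookup v i

NonIncreasing-tail : ∀ {x} {v : Vec ℚ M} → NonIncreasing (x ∷ v) → NonIncreasing v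
NonIncreasing-tail v↓ i j i≤j = v↓ (suc i) (suc j) (s≤s i≤j)

sumFirst-suc : ∀ (v : Vec ℚ M) y → sumFirst (suc y) v ≡ entry v y + sumFirst y v
sumFirst-suc []      zero    = sym (ℚ.+-identityˡ 0ℚ)
sumFirst-suc []      (suc y) = sym (ℚ.+-identityˡ 0ℚ)
sumFirst-suc (x ∷ v) zero    = refl
sumFirst-suc (x ∷ v) (suc y) = begin
  x + sumFirst (suc y) v             ≡⟨ cong (x +_) (sumFirst-suc v y) ⟩
  x + (entry v y + sumFirst y v)     ≡⟨ x∙yz≈y∙xz x (entry v y) (sumFirst y v) ⟩
  entry v y + (x + sumFirst y v)     ∎
  where
  open ≡-Reasoning
  open CommutativeSemigroupProperties (CommutativeMonoid.commutativeSemigroup ℚ.+-0-commutativeMonoid)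

sumFirst-nonNeg : {v : Vec ℚ M} → NonNegativeEntries v → ∀ y → 0ℚ ≤ℚ sumFirst y v
sumFirst-nonNeg {v = []}    v≥0 zero    = ℚ.≤-refl
sumFirst-nonNeg {v = []}    v≥0 (suc y) = ℚ.≤-refl
sumFirst-nonNeg {v = x ∷ v} v≥0 zero    = ℚ.≤-refl
sumFirst-nonNeg {v = x ∷ v} v≥0 (suc y) =
  ℚ.+-mono-≤ (v≥0 zero) (sumFirst-nonNeg (v≥0 ∘ suc) y)

sumFirst-mono : {v : Vec ℚ M} → NonNegativeEntries v →
                ∀ {x′ x} → x′ ≤ x → sumFirst x′ v ≤ℚ sumFirst x v
sumFirst-mono              v≥0 {x = x} z≤n = sumFirst-nonNeg v≥0 x
sumFirst-mono {v = []}     v≥0 (s≤s _)     = ℚ.≤-refl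
sumFirst-mono {v = x ∷ v}  v≥0 (s≤s x′≤x)  = ℚ.+-monoʳ-≤ x (sumFirst-mono (v≥0 ∘ suc) x′≤x)

entry-≤-head : ∀ {x} {v : Vec ℚ M} → NonIncreasing (x ∷ v) → NonNegativeEntries (x ∷ v) →
               ∀ y → entry v y ≤ℚ x
entry-≤-head {v = []}    v↓ v≥0 y       = v≥0 zero
entry-≤-head {v = x′ ∷ v} v↓ v≥0 zero    = v↓ zero (suc zero) z≤n
entry-≤-head {v = x′ ∷ v} v↓ v≥0 (suc y) =
  ℚ.≤-trans (entry-≤-head (NonIncreasing-tail v↓) (v≥0 ∘ suc) y) (v↓ zero (suc zero) z≤n)

entry*y≤sumFirst : {v : Vec ℚ M} → NonIncreasing v → NonNegativeEntries v →
                   ∀ y → entry v y * ℕtoℚ y ≤ℚ sumFirst y v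
entry*y≤sumFirst {v = v}     v↓ v≥0 zero    = ℚ.≤-reflexive (ℚ.*-zeroʳ (entry v 0))
entry*y≤sumFirst {v = []}    v↓ v≥0 (suc y) = ℚ.≤-reflexive (ℚ.*-zeroˡ (ℕtoℚ (suc y)))
entry*y≤sumFirst {v = x ∷ v} v↓ v≥0 (suc y) rewrite *-ℕtoℚ-suc (entry v y) y =
  ℚ.+-mono-≤ (entry-≤-head v↓ v≥0 y) (entry*y≤sumFirst (NonIncreasing-tail v↓) (v≥0 ∘ suc) y)

-- The paper's p ≤ wₓ with the division by x cleared.
RoIAt : ℚ → ℕ → Vec ℚ M → Set
RoIAt p x v = p * ℕtoℚ x ≤ℚ sumFirst x v

RoIAt-antitone-price : ∀ {p′ p x} {v : Vec ℚ M} → p′ ≤ℚ p → RoIAt p x v → RoIAt p′ x v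
RoIAt-antitone-price {x = x} p′≤p = ℚ.≤-trans (*-monoʳ-≤-ℕtoℚ x p′≤p)

-- If p ≤ v_{y+1} then p ≤ v_{y+1} ≤ w_y; otherwise dropping unit y+1 lowers the
-- payment by p but the value only by v_{y+1} < p.
RoIAt-pred : {v : Vec ℚ M} → NonIncreasing v → NonNegativeEntries v →
             ∀ {p} y → RoIAt p (suc y) v → RoIAt p y v
RoIAt-pred {v = v} v↓ v≥0 {p} y roi with p ℚ.≤? entry v y
... | yes p≤e = ℚ.≤-trans (*-monoʳ-≤-ℕtoℚ y p≤e) (entry*y≤sumFirst v↓ v≥0 y)
... | no  p≰e = ℚ.≮⇒≥ λ S<py → ℚ.<-irrefl refl (begin-strict
  sumFirst (suc y) v        ≡⟨ sumFirst-suc v y ⟩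
  entry v y + sumFirst y v  <⟨ ℚ.+-mono-< (ℚ.≰⇒> p≰e) S<py ⟩
  p + p * ℕtoℚ y            ≡⟨ *-ℕtoℚ-suc p y ⟨
  p * ℕtoℚ (suc y)          ≤⟨ roi ⟩
  sumFirst (suc y) v        ∎)
  where open ℚ.≤-Reasoning

RoIAt-antitone-quantity : {v : Vec ℚ M} → NonIncreasing v → NonNegativeEntries v →
                          ∀ {p x′ x} → x′ ≤ x → RoIAt p x v → RoIAt p x′ v
RoIAt-antitone-quantity {v = v} v↓ v≥0 {p} x′≤x = go (ℕ.≤⇒≤′ x′≤x)
  where
  go : ∀ {x′ x} → x′ ≤′ x → RoIAt p x v → RoIAt p x′ v
  go ≤′-refl          roi = roi
  go (≤′-step x′≤′x) roi = go x′≤′x (RoIAt-pred {v = v} v↓ v≥0 {p} _ roi)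

count : {P : Pred A p} → Decidable P → List A → ℕ
count P? = length ∘ filter P?

count-↭ : {P : Pred A p} (P? : Decidable P) {xs ys : List A} → xs ↭ ys → count P? xs ≡ count P? ys
count-↭ P? = ↭-length ∘ filter-↭ P?

count-mono : {P : Pred A p} {Q : Pred B q} {R : REL A B r} (P? : Decidable P) (Q? : Decidable Q) →
             (∀ {x y} → R x y → P x → Q y) →
             ∀ {xs ys} → Pointwise R xs ys → count P? xs ≤ count Q? ys
count-mono P? Q? R⇒ [] = z≤n
count-mono P? Q? R⇒ {x ∷ xs} {y ∷ ys} (xRy ∷ xsRys) with P? x | Q? y
... | yes px | yes _   = s≤s (count-mono P? Q? R⇒ xsRys)
... | yes px | no ¬qy  = contradiction (R⇒ xRy px) ¬qy
... | no _   | yes _   = ℕ.m≤n⇒m≤1+n (count-mono P? Q? R⇒ xsRys)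
... | no _   | no _    = count-mono P? Q? R⇒ xsRys

count-accept : {P : Pred A p} (P? : Decidable P) {x : A} {xs : List A} →
               P x → count P? (x ∷ xs) ≡ suc (count P? xs)
count-accept P? = cong length ∘ filter-accept P?

count-reject : {P : Pred A p} (P? : Decidable P) {x : A} {xs : List A} →
               ¬ P x → count P? (x ∷ xs) ≡ count P? xs
count-reject P? = cong length ∘ filter-reject P?

count-cons-≤ : {P : Pred A p} (P? : Decidable P) (x : A) (xs : List A) →
               count P? (x ∷ xs) ≤ suc (count P? xs)
count-cons-≤ P? x xs with P? x
... | yes _ = ℕ.≤-refl
... | no _  = ℕ.n≤1+n (count P? xs)

AllPairs-reverse⁺ : {R : REL A A r} {xs : List A} → AllPairs R xs → AllPairs (flip R) (reverse xs)
AllPairs-reverse⁺ []                        = []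
AllPairs-reverse⁺ {xs = x ∷ xs} (Rx ∷ Rxs) rewrite unfold-reverse x xs =
  AllPairs.++⁺ (AllPairs-reverse⁺ Rxs) ([] ∷ [])
               (All.map (_∷ []) (All-resp-↭ (↭-sym (↭-reverse xs)) Rx))

All-drop-head : {P : Pred A p} {xs : List A} → All P xs →
                ∀ n {y ys} → drop n xs ≡ y ∷ ys → P y
All-drop-head Pxs n eq = All.head (subst (All _) eq (drop⁺ n Pxs))

Descending : List ℚ → Set
Descending = AllPairs _≥_

sortDesc-descending : ∀ xs → Descending (sortDesc xs)
sortDesc-descending xs = AllPairs-reverse⁺ (Linked⇒AllPairs ℚ.≤-trans (sort-↗ xs))

sortDesc-↭ : ∀ xs → sortDesc xs ↭ xs
sortDesc-↭ xs = ↭-trans (↭-reverse (sort xs)) (sort-↭ xs)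

drop-descending-count-≤ : ∀ {xs} → Descending xs → ∀ n {y ys} → drop n xs ≡ y ∷ ys →
                          suc n ≤ count (y ℚ.≤?_) xs
drop-descending-count-≤ {x ∷ xs} _ zero refl
  rewrite count-accept (x ℚ.≤?_) {xs = xs} ℚ.≤-refl = s≤s z≤n
drop-descending-count-≤ {x ∷ xs} (x≥xs ∷ xs↓) (suc n) {y} eq
  rewrite count-accept (y ℚ.≤?_) {xs = xs} (All-drop-head x≥xs n eq) =
  s≤s (drop-descending-count-≤ xs↓ n eq)

drop-descending-count-< : ∀ {xs} → Descending xs → ∀ n {y ys} → drop n xs ≡ y ∷ ys →
                          count (y ℚ.<?_) xs ≤ n
drop-descending-count-< {x ∷ xs} (x≥xs ∷ _) zero refl
  rewrite count-reject (x ℚ.<?_) {xs = xs} (ℚ.<-irrefl refl) =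
  ℕ.≤-reflexive (cong length (filter-none (x ℚ.<?_) (All.map ≤⇒≯ x≥xs)))
  where
  ≤⇒≯ : ∀ {z} → z ≤ℚ x → ¬ x < z
  ≤⇒≯ z≤x x<z = ℚ.<-irrefl refl (ℚ.<-≤-trans x<z z≤x)
drop-descending-count-< {x ∷ xs} (_ ∷ xs↓) (suc n) {y} eq =
  ℕ.≤-trans (count-cons-≤ (y ℚ.<?_) x xs) (s≤s (drop-descending-count-< xs↓ n eq))

-- 0-indexed, and 0ℚ when there are at most n elements;
-- price K b β is nthHighest (K ∸ 1) (toList b ++ β).
nthHighest : ℕ → List ℚ → ℚ
nthHighest n xs = fromMaybe 0ℚ (head (drop n (sortDesc xs)))

sortDesc-drop-count-≤ : ∀ {xs} n {y ys} → drop n (sortDesc xs) ≡ y ∷ ys →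
                        suc n ≤ count (y ℚ.≤?_) xs
sortDesc-drop-count-≤ {xs} n {y} eq =
  subst (suc n ≤_) (count-↭ (y ℚ.≤?_) (sortDesc-↭ xs))
        (drop-descending-count-≤ (sortDesc-descending xs) n eq)

sortDesc-drop-count-< : ∀ {xs} n {y ys} → drop n (sortDesc xs) ≡ y ∷ ys →
                        count (y ℚ.<?_) xs ≤ n
sortDesc-drop-count-< {xs} n {y} eq =
  subst (_≤ n) (count-↭ (y ℚ.<?_) (sortDesc-↭ xs))
        (drop-descending-count-< (sortDesc-descending xs) n eq)

length-drop-sortDesc : ∀ n {xs ys us ws} {R : REL ℚ ℚ r} → Pointwise R xs ys →
                       drop n (sortDesc xs) ≡ us → drop n (sortDesc ys) ≡ ws → length us ≡ length ws
length-drop-sortDesc n {xs} {ys} xsRys refl refl = begin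
  length (drop n (sortDesc xs))  ≡⟨ length-drop n (sortDesc xs) ⟩
  length (sortDesc xs) ∸ n       ≡⟨ cong (_∸ n) (↭-length (sortDesc-↭ xs)) ⟩
  length xs ∸ n                  ≡⟨ cong (_∸ n) (Pointwise-length xsRys) ⟩
  length ys ∸ n                  ≡⟨ cong (_∸ n) (↭-length (sortDesc-↭ ys)) ⟨
  length (sortDesc ys) ∸ n       ≡⟨ length-drop n (sortDesc ys) ⟨
  length (drop n (sortDesc ys))  ∎
  where open ≡-Reasoning

-- If the n-th highest y of ys were below the n-th highest y′ of xs, then more than n
-- elements of ys would exceed y.
nthHighest-mono : ∀ n {xs ys} → Pointwise _≤ℚ_ xs ys → nthHighest n xs ≤ℚ nthHighest n ys
nthHighest-mono n {xs} {ys} xs≤ys with drop n (sortDesc xs) in eqx | drop n (sortDesc ys) in eqy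
... | []     | []     = ℚ.≤-refl
... | []     | _ ∷ _  = contradiction (length-drop-sortDesc n xs≤ys eqx eqy) λ ()
... | _ ∷ _  | []     = contradiction (length-drop-sortDesc n xs≤ys eqx eqy) λ ()
... | y′ ∷ _ | y ∷ _  = ℚ.≮⇒≥ λ y<y′ → ℕ.<-irrefl refl (begin
  suc n                 ≤⟨ sortDesc-drop-count-≤ n eqx ⟩
  count (y′ ℚ.≤?_) xs   ≤⟨ count-mono (y′ ℚ.≤?_) (y ℚ.<?_)
                             (λ x≤z y′≤x → ℚ.<-≤-trans y<y′ (ℚ.≤-trans y′≤x x≤z)) xs≤ys ⟩
  count (y ℚ.<?_) ys    ≤⟨ sortDesc-drop-count-< n eqy ⟩
  n                     ∎)
  where open ℕ.≤-Reasoning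

toList-pointwise : ∀ {R : REL A B r} {xs : Vec A n} {ys : Vec B n} →
                   (∀ i → R (lookup xs i) (lookup ys i)) → Pointwise R (toList xs) (toList ys)
toList-pointwise {xs = []}     {[]}     _   = []
toList-pointwise {xs = x ∷ xs} {y ∷ ys} xRy = xRy zero ∷ toList-pointwise (xRy ∘ suc)

countAbove-antitone : ∀ {t′ t} → t′ ≤ℚ t → ∀ β → countAbove t β ≤ countAbove t′ β
countAbove-antitone {t′} {t} t′≤t β =
  count-mono (t ℚ.<?_) (t′ ℚ.<?_) (λ { refl t<x → ℚ.≤-<-trans t′≤t t<x })
             (Pointwise.refl {R = _≡_} refl {β})

winIndicator-antitone : ∀ K {m m′} → m ≤ m′ → (if m′ ≤ᵇ K then 1 else 0) ≤ (if m ≤ᵇ K then 1 else 0)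
winIndicator-antitone K {m} {m′} m≤m′ with m′ ≤ᵇ K | ℕ.≤ᵇ-reflects-≤ m′ K | m ≤ᵇ K | ℕ.≤ᵇ-reflects-≤ m K
... | false | _          | _     | _        = z≤n
... | true  | _          | true  | _        = ℕ.≤-refl
... | true  | ofʸ m′≤K   | false | ofⁿ m≰K  = contradiction (ℕ.≤-trans m≤m′ m′≤K) m≰K

winsFrom-mono : ∀ K j {k} (b′ b : Vec ℚ k) → (∀ i → lookup b′ i ≤ℚ lookup b i) →
                ∀ β → winsFrom K j b′ β ≤ winsFrom K j b β
winsFrom-mono K j []        []      _    β = z≤n
winsFrom-mono K j (x′ ∷ b′) (x ∷ b) b′≤b β =
  ℕ.+-mono-≤ (winIndicator-antitone K (ℕ.+-monoʳ-≤ (suc j) (countAbove-antitone (b′≤b zero) β)))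
             (winsFrom-mono K (suc j) b′ b (b′≤b ∘ suc) β)

price-mono : ∀ K {k} (b′ b : Vec ℚ k) → (∀ i → lookup b′ i ≤ℚ lookup b i) →
             ∀ β → price K b′ β ≤ℚ price K b β
price-mono K b′ b b′≤b β =
  nthHighest-mono (K ∸ 1)
    (Pointwise.++⁺ (toList-pointwise {xs = b′} {b} b′≤b) (Pointwise.refl ℚ.≤-refl))

mainTheorem13 : (K M k : ℕ) → 1 ≤ K → k ≤ M
    → (v : Vec ℚ M) → NonIncreasing v → (∀ i → 0ℚ < lookup v i)
    → (b b′ : Vec ℚ k) → NonIncreasing b → NonIncreasing b′
    → (∀ j → lookup b′ j ≤ℚ lookup b j)
    → (β : List ℚ)
    → RoIFeasible K v b β
    → RoIFeasible K v b′ β × value K v b′ β ≤ℚ value K v b β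
mainTheorem13 K M k _ _ v v↓ v>0 b b′ _ _ b′≤b β roi =
  RoIAt-antitone-price {x = x′} (price-mono K b′ b b′≤b β) roi-at-x′ , sumFirst-mono v≥0 x′≤x
  where
  x′ x : ℕ
  x′ = alloc K b′ β
  x  = alloc K b β
  v≥0 : NonNegativeEntries v
  v≥0 = ℚ.<⇒≤ ∘ v>0
  x′≤x : x′ ≤ x
  x′≤x = winsFrom-mono K 0 b′ b b′≤b β
  roi-at-x′ : RoIAt (price K b β) x′ v
  roi-at-x′ = RoIAt-antitone-quantity v↓ v≥0 {p = price K b β} x′≤x roi
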